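{- Let $G$ be a graph on $n$ vertices with adjacency matrix $A$ and walk matrix $W$, let $H^{(v)}$ be a rooted graph on $m$ vertices, and let $\tilde W$ be the walk matrix of the rooted product $G\circ H^{(v)}$, with vertices labeled so that $A(G\circ H^{(v)})=A(H)\otimes I_n+D_v\otimes A$. Let $p$ be an odd prime factor of $\det W$. If $\alpha\in\mathcal{N}(W^\top)\subseteq\mathbb{F}_p^n$, then $u\otimes\alpha\in\mathcal{N}(\tilde W^\top)\subseteq\mathbb{F}_p^{mn}$ for every $u\in\mathbb{F}_p^m$.
   Context: The walk matrix of a $N$-vertex graph with adjacency matrix $M$ is $[e,Me,\dots,M^{N-1}e]$, $e$ the all-ones vector of appropriate length. $\mathcal{N}(X^\top)$ denotes the left null space of $X$ over $\mathbb{F}_p$. A rooted graph $H^{(v)}$ is a graph $H$ with a distinguished vertex $v$. The rooted product $G\circ H^{(v)}$ is obtained from $G$ and $n$ copies of $H$ by identifying the root of the $i$-th copy of $H$ with the $i$-th vertex of $G$, for each $i$. $D_v$ is the $m\times m$ diagonal matrix with a single nonzero entry $1$ in the position of $v$, and $\otimes$ is the Kronecker product. -}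

module Defs where

open import Data.Nat using (ℕ; zero; suc)
import Data.Nat as ℕ
open import Data.Bool using (Bool; true; false; _∧_; _∨_; T)
open import Data.Fin using (Fin; zero; suc; punchIn; remQuot; combine; toℕ)
open import Data.Fin.Properties using (_≟_)
open import Data.Integer using (ℤ; +_; _+_; _*_; -_)
open import Data.Integer.Divisibility using (_∣_)
open import Data.Product using (_×_; _,_)
open import Relation.Binary.PropositionalEquality using (_≡_)
open import Relation.Nullary using (¬_)
open import Relation.Nullary.Decidable using (⌊_⌋)

Matrix : ℕ → ℕ → Set
Matrix r c = Fin r → Fin c → ℤ

Vector : ℕ → Set
Vector k = Fin k → ℤ

sumFin : (k : ℕ) → (Fin k → ℤ) → ℤ
sumFin zero    f = + 0
sumFin (suc k) f = f zero + sumFin k (λ i → f (suc i))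

det : (k : ℕ) → Matrix k k → ℤ
det zero    M = + 1
det (suc k) M = sumFin (suc k) λ j →
  sign j * (M zero j * det k (λ r c → M (suc r) (punchIn j c)))
  where
    signℕ : {l : ℕ} → Fin l → ℤ
    signℕ zero    = + 1
    signℕ (suc i) = - signℕ i
    sign : Fin (suc k) → ℤ
    sign = signℕ

record Graph (N : ℕ) : Set where
  field
    adj       : Fin N → Fin N → Bool
    symmetric : ∀ i j → adj i j ≡ adj j i
    loopless  : ∀ i → adj i i ≡ false
open Graph public

boolℤ : Bool → ℤ
boolℤ true  = + 1
boolℤ false = + 0

adjMatrix : {N : ℕ} → Graph N → Matrix N N
adjMatrix G i j = boolℤ (adj G i j)

matVec : {r c : ℕ} → Matrix r c → Vector c → Vector r
matVec {c = c} M x i = sumFin c λ j → M i j * x j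

powOnes : {N : ℕ} → Matrix N N → ℕ → Vector N
powOnes M zero    = λ _ → + 1
powOnes M (suc k) = matVec M (powOnes M k)

walkMatrixOf : {N : ℕ} → Matrix N N → Matrix N N
walkMatrixOf M i k = powOnes M (toℕ k) i

walkMatrix : {N : ℕ} → Graph N → Matrix N N
walkMatrix G = walkMatrixOf (adjMatrix G)

-- α lies in the left null space N(X^T) over F_p (α given by integer representatives):
-- α^T X ≡ 0 (mod p) componentwise.
InLeftNullSpaceMod : {r c : ℕ} → ℕ → Matrix r c → Vector r → Set
InLeftNullSpaceMod {r} {c} p X α =
  (j : Fin c) → (+ p) ∣ sumFin r (λ i → α i * X i j)

-- Kronecker product of vectors, u ⊗ α, with index (a,i) ↦ a*n + i (Data.Fin.combine).
kronVec : {m n : ℕ} → Vector m → Vector n → Vector (m ℕ.* n)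
kronVec {m} {n} u α x with remQuot {m} n x
... | a , i = u a * α i

-- Rooted product G ∘ H^(v), vertices labelled (a,i) ↦ a*n + i so that
-- A(G∘H^(v)) = A(H) ⊗ I_n + D_v ⊗ A(G):
-- (a,i) ~ (b,j)  iff  (a ~_H b and i = j)  or  (a = v = b and i ~_G j).
rootedAdj : {n m : ℕ} → Graph n → Graph m → Fin m → Fin (m ℕ.* n) → Fin (m ℕ.* n) → Bool
rootedAdj {n} {m} G H v x y with remQuot {m} n x | remQuot {m} n y
... | a , i | b , j =
  (adj H a b ∧ ⌊ i ≟ j ⌋) ∨ (⌊ a ≟ v ⌋ ∧ (⌊ b ≟ v ⌋ ∧ adj G i j))

rootedProductAdjMatrix : {n m : ℕ} → Graph n → Graph m → Fin m → Matrix (m ℕ.* n) (m ℕ.* n)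
rootedProductAdjMatrix G H v x y = boolℤ (rootedAdj G H v x y)

rootedProductWalkMatrix : {n m : ℕ} → Graph n → Graph m → Fin m → Matrix (m ℕ.* n) (m ℕ.* n)
rootedProductWalkMatrix G H v = walkMatrixOf (rootedProductAdjMatrix G H v)

{-# OPTIONS --safe #-}
-- Over 𝔽_p the vectors e, Ae, …, Aⁿe (A = A(G)) are linearly dependent, with a unit leading
-- coefficient at some degree d ≤ n. Multiplying that dependence by αᵀAᵗ shows that αᵀAʲe satisfies
-- a linear recurrence of order d, so its vanishing for j < n (that is, α ∈ 𝒩(Wᵀ)) propagates to
-- every j. Hence Y = {y | αᵀAᵗy ≡ 0 for all t} is an A-invariant subspace containing e. Cutting a
-- vector z of the rooted product into blocks z_a of length n, block a of Ã z is
-- Σ_b A(H)_ab z_b + [a = v] A z_v, so every block of every Ãᵏe lies in Y, and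
-- (u ⊗ α)ᵀÃᵏe = Σ_a u_a αᵀ(Ãᵏe)_a ≡ 0.
module Submission where

open import Defs
open import Data.Nat using (ℕ)
open import Data.Nat.Primality using (Prime)
open import Data.Integer using (+_)
open import Data.Integer.Divisibility using (_∣_)
open import Data.Fin using (Fin)
open import Relation.Binary.PropositionalEquality using (_≢_)

open import Data.Bool using (true; false; _∧_; _∨_; T)
open import Data.Bool.Properties using (T-∧)
open import Data.Empty using (⊥)
open import Data.Fin using (zero; suc; toℕ; fromℕ; fromℕ<; inject₁; combine; punchIn; punchOut; _↑ˡ_; _↑ʳ_)
open import Data.Fin.Properties
  using (_≟_; all?; ¬∀⟶∃¬; punchInᵢ≢i; punchIn-punchOut; remQuot-combine;
         toℕ-fromℕ; toℕ-fromℕ<; toℕ-inject₁; toℕ<n)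
open import Data.Integer using (ℤ; 0ℤ; _+_; _*_; -_; _-_; ∣_∣)
open import Data.Integer.Properties as ℤ using (+-*-semiring; *-commutativeSemigroup)
open import Algebra.Properties.CommutativeSemigroup *-commutativeSemigroup using (x∙yz≈y∙xz)
import Data.Integer.Divisibility.Signed as Signed
open import Data.Integer.Tactic.RingSolver using (solve-∀)
open import Data.Nat as ℕ using (zero; suc; _≤_; _<_; _<?_; _∸_)
open import Data.Nat.Induction using (<-rec)
import Data.Nat.Divisibility as ℕ
open import Data.Nat.Primality using (euclidsLemma; ¬prime[1])
import Data.Nat.Properties as ℕ
open import Data.Product using (_,_)
open import Data.Sum as Sum using (_⊎_; [_,_]′)
open import Data.Vec.Functional using (_∷_)
open import Algebra.Properties.Semiring.Sum +-*-semiring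
  using (sum; sum-syntax; sum-cong-≗; sum-remove; sum-replicate-zero; sum-init-last;
         ∑-distrib-+; ∑-comm; *-distribˡ-sum; *-distribʳ-sum)
open import Function using (_∘_; id; Equivalence)
open import Relation.Nullary using (¬_; yes; no; contradiction)
open import Relation.Nullary.Decidable using (⌊_⌋; toWitness)
open import Relation.Binary.PropositionalEquality
  using (_≡_; refl; sym; trans; cong; cong₂; subst; module ≡-Reasoning)
open ≡-Reasoning

sumFin≡sum : ∀ k (f : Vector k) → sumFin k f ≡ sum f
sumFin≡sum zero    f = refl
sumFin≡sum (suc k) f = cong (_+_ (f zero)) (sumFin≡sum k (f ∘ suc))

∑-splitAt : ∀ a b (f : Vector (a ℕ.+ b)) →
  sum f ≡ ∑[ i < a ] f (i ↑ˡ b) + ∑[ j < b ] f (a ↑ʳ j)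
∑-splitAt zero    b f = sym (ℤ.+-identityˡ _)
∑-splitAt (suc a) b f = trans (cong (_+_ (f zero)) (∑-splitAt a b (f ∘ suc))) (sym (ℤ.+-assoc (f zero) _ _))

∑-combine : ∀ m n (f : Vector (m ℕ.* n)) → sum f ≡ ∑[ a < m ] ∑[ i < n ] f (combine a i)
∑-combine zero    n f = refl
∑-combine (suc m) n f = trans (∑-splitAt n (m ℕ.* n) f)
  (cong (_+_ (∑[ i < n ] f (i ↑ˡ (m ℕ.* n)))) (∑-combine m n (f ∘ (n ↑ʳ_))))

∑-supported : ∀ {n} (f : Vector n) i → (∀ j → j ≢ i → f j ≡ 0ℤ) → sum f ≡ f i
∑-supported {suc n} f i f≡0 = begin
  sum f                              ≡⟨ sum-remove f ⟩
  f i + ∑[ j < n ] f (punchIn i j)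
    ≡⟨ cong (_+_ (f i)) (sum-cong-≗ λ j → f≡0 (punchIn i j) (punchInᵢ≢i i j)) ⟩
  f i + ∑[ j < n ] 0ℤ                ≡⟨ cong (_+_ (f i)) (sum-replicate-zero n) ⟩
  f i + 0ℤ                           ≡⟨ ℤ.+-identityʳ (f i) ⟩
  f i                                ∎

sumTo : ℕ → (ℕ → ℤ) → ℤ
sumTo k h = ∑[ i < k ] h (toℕ i)

sumTo-suc : ∀ k (h : ℕ → ℤ) → sumTo (suc k) h ≡ sumTo k h + h k
sumTo-suc k h = begin
  sumTo (suc k) h                                      ≡⟨ sum-init-last {k} (h ∘ toℕ) ⟩
  ∑[ i < k ] h (toℕ (inject₁ i)) + h (toℕ (fromℕ k))
    ≡⟨ cong₂ _+_ (sum-cong-≗ {k} (cong h ∘ toℕ-inject₁)) (cong h (toℕ-fromℕ k)) ⟩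
  sumTo k h + h k                                      ∎

δ : ∀ {n} → Fin n → Fin n → ℤ
δ i j = boolℤ ⌊ i ≟ j ⌋

δ-refl : ∀ {n} (i : Fin n) → δ i i ≡ + 1
δ-refl i with i ≟ i
... | yes _  = refl
... | no i≢i = contradiction refl i≢i

δ-≢ : ∀ {n} {i j : Fin n} → i ≢ j → δ i j ≡ 0ℤ
δ-≢ {i = i} {j} i≢j with i ≟ j
... | yes i≡j = contradiction i≡j i≢j
... | no _    = refl

∑-δˡ : ∀ {n} (i : Fin n) (f : Vector n) → ∑[ j < n ] (δ i j * f j) ≡ f i
∑-δˡ i f = trans (∑-supported _ i λ j j≢i → cong (_* f j) (δ-≢ (j≢i ∘ sym)))
                 (trans (cong (_* f i) (δ-refl i)) (ℤ.*-identityˡ (f i)))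

∑-δʳ : ∀ {n} (i : Fin n) (f : Vector n) → ∑[ j < n ] (δ j i * f j) ≡ f i
∑-δʳ i f = trans (∑-supported _ i λ j j≢i → cong (_* f j) (δ-≢ j≢i))
                 (trans (cong (_* f i) (δ-refl i)) (ℤ.*-identityˡ (f i)))

infix 7 _·_
_·_ : ∀ {n} → Vector n → Vector n → ℤ
_·_ {n} x y = ∑[ i < n ] (x i * y i)

infixl 8 _ᵀ*_
_ᵀ*_ : ∀ {n} → Vector n → Matrix n n → Vector n
_ᵀ*_ {n} b M j = ∑[ i < n ] (b i * M i j)

·-∑ : ∀ {n k} (b : Vector n) (g : Vector k) (Y : Fin k → Vector n) →
  b · (λ r → ∑[ i < k ] (g i * Y i r)) ≡ ∑[ i < k ] (g i * (b · Y i))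
·-∑ {n} {k} b g Y = begin
  ∑[ r < n ] (b r * ∑[ i < k ] (g i * Y i r))   ≡⟨ sum-cong-≗ (λ r → *-distribˡ-sum {k} (b r) _) ⟩
  ∑[ r < n ] ∑[ i < k ] (b r * (g i * Y i r))   ≡⟨ ∑-comm {n} {k} _ ⟩
  ∑[ i < k ] ∑[ r < n ] (b r * (g i * Y i r))
    ≡⟨ sum-cong-≗ (λ i → sum-cong-≗ λ r → x∙yz≈y∙xz (b r) (g i) (Y i r)) ⟩
  ∑[ i < k ] ∑[ r < n ] (g i * (b r * Y i r))   ≡⟨ sum-cong-≗ (λ i → sym (*-distribˡ-sum {n} (g i) _)) ⟩
  ∑[ i < k ] (g i * (b · Y i))                  ∎

·-ᵀ* : ∀ {n} (b : Vector n) (M : Matrix n n) (y : Vector n) → (b ᵀ* M) · y ≡ b · matVec M y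
·-ᵀ* {n} b M y = begin
  ∑[ s < n ] (∑[ i < n ] (b i * M i s) * y s)   ≡⟨ sum-cong-≗ (λ s → *-distribʳ-sum {n} (y s) _) ⟩
  ∑[ s < n ] ∑[ i < n ] (b i * M i s * y s)     ≡⟨ ∑-comm {n} {n} _ ⟩
  ∑[ i < n ] ∑[ s < n ] (b i * M i s * y s)
    ≡⟨ sum-cong-≗ (λ i → sum-cong-≗ λ s → ℤ.*-assoc (b i) (M i s) (y s)) ⟩
  ∑[ i < n ] ∑[ s < n ] (b i * (M i s * y s))   ≡⟨ sum-cong-≗ (λ i → sym (*-distribˡ-sum {n} (b i) _)) ⟩
  ∑[ i < n ] (b i * ∑[ s < n ] (M i s * y s))   ≡⟨ sum-cong-≗ (λ i → cong (b i *_) (sym (sumFin≡sum n _))) ⟩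
  b · matVec M y                                ∎

slice : ∀ {m n} → Vector (m ℕ.* n) → Fin m → Vector n
slice z a i = z (combine a i)

slice-matVec-blockwise : ∀ {m n} (M : Matrix (m ℕ.* n) (m ℕ.* n)) z (a : Fin m) (i : Fin n) →
  slice (matVec M z) a i ≡ ∑[ b < m ] ∑[ j < n ] (M (combine a i) (combine b j) * slice z b j)
slice-matVec-blockwise {m} {n} M z a i = trans (sumFin≡sum (m ℕ.* n) _) (∑-combine m n _)

kronVec-combine : ∀ {m n} (u : Vector m) (α : Vector n) a i → kronVec u α (combine a i) ≡ u a * α i
kronVec-combine u α a i = cong (λ (b , j) → u b * α j) (remQuot-combine a i)

·-kronVec : ∀ {m n} (u : Vector m) (α : Vector n) (z : Vector (m ℕ.* n)) →
  kronVec u α · z ≡ ∑[ a < m ] (u a * (α · slice z a))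
·-kronVec {m} {n} u α z = begin
  kronVec u α · z                                          ≡⟨ ∑-combine m n _ ⟩
  ∑[ a < m ] ∑[ i < n ] (kronVec u α (combine a i) * slice z a i)
    ≡⟨ sum-cong-≗ (λ a → sum-cong-≗ λ i →
         trans (cong (_* slice z a i) (kronVec-combine u α a i)) (ℤ.*-assoc (u a) _ _)) ⟩
  ∑[ a < m ] ∑[ i < n ] (u a * (α i * slice z a i))      ≡⟨ sum-cong-≗ (λ a → sym (*-distribˡ-sum {n} (u a) _)) ⟩
  ∑[ a < m ] (u a * (α · slice z a))                       ∎

record IsWalkClosed {n} (A : Matrix n n) (P : Vector n → Set) : Set where
  field
    ≗-closed : ∀ {x y} → (∀ i → x i ≡ y i) → P x → P y
    ∑-closed : ∀ {k} (g : Vector k) (Y : Fin k → Vector n) → (∀ i → P (Y i)) →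
               P (λ r → ∑[ i < k ] (g i * Y i r))
    A-closed : ∀ {y} → P y → P (matVec A y)
    ones     : P (λ _ → + 1)

boolℤ-∧ : ∀ x y → boolℤ (x ∧ y) ≡ boolℤ x * boolℤ y
boolℤ-∧ true  true  = refl
boolℤ-∧ true  false = refl
boolℤ-∧ false true  = refl
boolℤ-∧ false false = refl

boolℤ-∨ : ∀ x y → (T x → T y → ⊥) → boolℤ (x ∨ y) ≡ boolℤ x + boolℤ y
boolℤ-∨ true  true  disjoint = contradiction _ (disjoint _)
boolℤ-∨ true  false _        = refl
boolℤ-∨ false true  _        = refl
boolℤ-∨ false false _        = refl

module RootedProduct {n m} (G : Graph n) (H : Graph m) (v : Fin m) where

  private
    A : Matrix n n
    A = adjMatrix G
    AH : Matrix m m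
    AH = adjMatrix H
    B : Matrix (m ℕ.* n) (m ℕ.* n)
    B = rootedProductAdjMatrix G H v

  rootedProductAdj-combine : ∀ (a : Fin m) (i : Fin n) b j →
    B (combine a i) (combine b j) ≡ AH a b * δ i j + δ a v * (δ b v * A i j)
  rootedProductAdj-combine a i b j = begin
    B (combine a i) (combine b j)
      ≡⟨ cong₂ (λ (a , i) (b , j) → boolℤ ((adj H a b ∧ ⌊ i ≟ j ⌋) ∨ (⌊ a ≟ v ⌋ ∧ (⌊ b ≟ v ⌋ ∧ adj G i j))))
               (remQuot-combine a i) (remQuot-combine b j) ⟩
    boolℤ ((adj H a b ∧ ⌊ i ≟ j ⌋) ∨ (⌊ a ≟ v ⌋ ∧ (⌊ b ≟ v ⌋ ∧ adj G i j)))
      ≡⟨ boolℤ-∨ (adj H a b ∧ ⌊ i ≟ j ⌋) (⌊ a ≟ v ⌋ ∧ (⌊ b ≟ v ⌋ ∧ adj G i j)) no-loop ⟩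
    boolℤ (adj H a b ∧ ⌊ i ≟ j ⌋) + boolℤ (⌊ a ≟ v ⌋ ∧ (⌊ b ≟ v ⌋ ∧ adj G i j))
      ≡⟨ cong₂ _+_ (boolℤ-∧ (adj H a b) ⌊ i ≟ j ⌋)
                   (trans (boolℤ-∧ ⌊ a ≟ v ⌋ _) (cong (δ a v *_) (boolℤ-∧ ⌊ b ≟ v ⌋ (adj G i j)))) ⟩
    AH a b * δ i j + δ a v * (δ b v * A i j)
      ∎
    where
    no-loop : T (adj H a b ∧ ⌊ i ≟ j ⌋) → T (⌊ a ≟ v ⌋ ∧ (⌊ b ≟ v ⌋ ∧ adj G i j)) → ⊥
    no-loop h₁ h₂ with Equivalence.to (T-∧ {adj H a b}) h₁ | Equivalence.to (T-∧ {⌊ a ≟ v ⌋}) h₂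
    ... | a~b , _ | a≟v , h₃ with Equivalence.to (T-∧ {⌊ b ≟ v ⌋}) h₃
    ... | b≟v , _ with toWitness {a? = a ≟ v} a≟v | toWitness {a? = b ≟ v} b≟v
    ... | refl | refl = subst T (loopless H v) a~b

  slice-matVec : ∀ (z : Vector (m ℕ.* n)) a i →
    slice (matVec B z) a i ≡ δ a v * matVec A (slice z v) i + ∑[ b < m ] (AH a b * slice z b i)
  slice-matVec z a i = begin
    slice (matVec B z) a i
      ≡⟨ slice-matVec-blockwise B z a i ⟩
    ∑[ b < m ] ∑[ j < n ] (B (combine a i) (combine b j) * slice z b j)
      ≡⟨ sum-cong-≗ (λ b → sum-cong-≗ λ j →
           trans (cong (_* slice z b j) (rootedProductAdj-combine a i b j))
                 (distribute (AH a b) (δ i j) (δ a v) (δ b v) (A i j) (slice z b j))) ⟩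
    ∑[ b < m ] ∑[ j < n ] (AH a b * (δ i j * slice z b j) + δ b v * (δ a v * (A i j * slice z b j)))
      ≡⟨ trans (sum-cong-≗ {m} (λ b → ∑-distrib-+ {n} _ _)) (∑-distrib-+ {m} _ _) ⟩
    ∑[ b < m ] ∑[ j < n ] (AH a b * (δ i j * slice z b j))
      + ∑[ b < m ] ∑[ j < n ] (δ b v * (δ a v * (A i j * slice z b j)))
      ≡⟨ cong₂ _+_ (sum-cong-≗ λ b → trans (sym (*-distribˡ-sum {n} (AH a b) _)) (cong (AH a b *_) (∑-δˡ i _)))
                   (trans (sum-cong-≗ λ b → trans (sym (*-distribˡ-sum {n} (δ b v) _))
                                                  (cong (δ b v *_) (sym (*-distribˡ-sum {n} (δ a v) _))))
                          (∑-δʳ v _)) ⟩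
    ∑[ b < m ] (AH a b * slice z b i) + δ a v * ∑[ j < n ] (A i j * slice z v j)
      ≡⟨ ℤ.+-comm (∑[ b < m ] (AH a b * slice z b i)) _ ⟩
    δ a v * ∑[ j < n ] (A i j * slice z v j) + ∑[ b < m ] (AH a b * slice z b i)
      ≡⟨ cong (λ s → δ a v * s + ∑[ b < m ] (AH a b * slice z b i)) (sym (sumFin≡sum n _)) ⟩
    δ a v * matVec A (slice z v) i + ∑[ b < m ] (AH a b * slice z b i)
      ∎
    where
    distribute : ∀ h d₁ d₂ d₃ g x → (h * d₁ + d₂ * (d₃ * g)) * x ≡ h * (d₁ * x) + d₃ * (d₂ * (g * x))
    distribute = solve-∀

  walkSlices-closed : ∀ {P} → IsWalkClosed A P → ∀ t a → P (slice (powOnes B t) a)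
  walkSlices-closed closed zero    a = IsWalkClosed.ones closed
  -- By slice-matVec, block a of B z combines m + 1 vectors: the root term, then the blocks of z.
  walkSlices-closed closed (suc t) a =
    ≗-closed (λ i → sym (slice-matVec z a i))
             (∑-closed (δ a v ∷ AH a) (matVec A (slice z v) ∷ slice z) λ where
               zero    → A-closed (walkSlices-closed closed t v)
               (suc b) → walkSlices-closed closed t b)
    where
    open IsWalkClosed closed
    z : Vector (m ℕ.* n)
    z = powOnes B t

module Modulo (p : ℕ) where

  infix 4 p∣_
  p∣_ : ℤ → Set
  p∣ x = + p Signed.∣ x

  p∣0 : p∣ 0ℤ
  p∣0 = Signed.divides 0ℤ refl

  p∣-∑ : ∀ {k} (f : Vector k) → (∀ i → p∣ f i) → p∣ sum f
  p∣-∑ {zero}  f _   = p∣0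
  p∣-∑ {suc k} f p∣f = Signed.∣m∣n⇒∣m+n (p∣f zero) (p∣-∑ (f ∘ suc) (p∣f ∘ suc))

  record LinearDependence {n} (w : ℕ → Vector n) : Set where
    field
      degree    : ℕ
      degree≤n  : degree ≤ n
      coeff     : ℕ → ℤ
      p∤leading : ¬ p∣ coeff degree
      relation  : ∀ r → p∣ sumTo (suc degree) (λ i → coeff i * w i r)

  module _ (p-prime : Prime p) where

    p∤1 : ¬ p∣ + 1
    p∤1 p∣1 = ¬prime[1] (subst Prime (ℕ.∣1⇒≡1 (Signed.∣⇒∣ᵤ p∣1)) p-prime)

    p∣-euclid : ∀ x y → p∣ x * y → p∣ x ⊎ p∣ y
    p∣-euclid x y p∣xy = Sum.map Signed.∣ᵤ⇒∣ Signed.∣ᵤ⇒∣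
      (euclidsLemma ∣ x ∣ ∣ y ∣ p-prime (subst (p ℕ.∣_) (ℤ.abs-* x y) (Signed.∣⇒∣ᵤ p∣xy)))

    dependence-degree0 : ∀ {n} (w : ℕ → Vector n) → (∀ r → p∣ w 0 r) → LinearDependence w
    dependence-degree0 w p∣w₀ = record
      { degree    = 0
      ; degree≤n  = ℕ.z≤n
      ; coeff     = λ _ → + 1
      ; p∤leading = p∤1
      ; relation  = λ r → subst p∣_ (sym (unit (w 0 r))) (p∣w₀ r)
      }
      where
      unit : ∀ x → + 1 * x + 0ℤ ≡ x
      unit = solve-∀

    -- Gaussian elimination step: the eliminated vectors vanish at the pivot r₀, so a dependence
    -- among their other n coordinates lifts to one among the w i.
    module Elimination {n} (w : ℕ → Vector (suc n)) (r₀ : Fin (suc n)) where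

      eliminated : ℕ → Vector (suc n)
      eliminated i r = w 0 r₀ * w (suc i) r - w (suc i) r₀ * w 0 r

      eliminated-r₀ : ∀ i → eliminated i r₀ ≡ 0ℤ
      eliminated-r₀ i = cancel (w 0 r₀) (w (suc i) r₀)
        where
        cancel : ∀ a b → a * b - b * a ≡ 0ℤ
        cancel = solve-∀

      dependence-lift : ¬ p∣ w 0 r₀ → LinearDependence (λ i j → eliminated i (punchIn r₀ j)) → LinearDependence w
      dependence-lift p∤pivot dep = record
        { degree    = suc degree
        ; degree≤n  = ℕ.s≤s degree≤n
        ; coeff     = c
        ; p∤leading = λ p∣c → [ p∤pivot , p∤leading ]′ (p∣-euclid (w 0 r₀) (coeff degree) p∣c)
        ; relation  = relation′
        }
        where
        open LinearDependence dep
        pivot-tail : ℤ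
        pivot-tail = sumTo (suc degree) (λ i → coeff i * w (suc i) r₀)

        c : ℕ → ℤ
        c zero    = - pivot-tail
        c (suc i) = w 0 r₀ * coeff i

        c-eliminated : ∀ r →
          sumTo (suc degree) (λ i → coeff i * eliminated i r) ≡ sumTo (suc (suc degree)) (λ i → c i * w i r)
        c-eliminated r = begin
          sumTo (suc degree) (λ i → coeff i * eliminated i r)
            ≡⟨ sum-cong-≗ {suc degree} (λ i →
                 expand (w 0 r₀) (coeff (toℕ i)) (w (suc (toℕ i)) r) (w (suc (toℕ i)) r₀) (w 0 r)) ⟩
          sumTo (suc degree) (λ i → c (suc i) * w (suc i) r + (- w 0 r) * (coeff i * w (suc i) r₀))
            ≡⟨ ∑-distrib-+ {suc degree} (λ i → c (suc (toℕ i)) * w (suc (toℕ i)) r)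
                                        (λ i → (- w 0 r) * (coeff (toℕ i) * w (suc (toℕ i)) r₀)) ⟩
          tail + sumTo (suc degree) (λ i → (- w 0 r) * (coeff i * w (suc i) r₀))
            ≡⟨ cong (_+_ tail)
                 (sym (*-distribˡ-sum {suc degree} (- w 0 r) (λ i → coeff (toℕ i) * w (suc (toℕ i)) r₀))) ⟩
          tail + (- w 0 r) * pivot-tail
            ≡⟨ swap tail pivot-tail (w 0 r) ⟩
          c 0 * w 0 r + tail
            ∎
          where
          tail : ℤ
          tail = sumTo (suc degree) (λ i → c (suc i) * w (suc i) r)
          expand : ∀ a k x y z → k * (a * x - y * z) ≡ a * k * x + (- z) * (k * y)
          expand = solve-∀
          swap : ∀ s t z → s + (- z) * t ≡ (- t) * z + s
          swap = solve-∀

        relation′ : ∀ r → p∣ sumTo (suc (suc degree)) (λ i → c i * w i r)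
        relation′ r with r ≟ r₀
        ... | yes refl = subst p∣_ (c-eliminated r₀)
                           (p∣-∑ {suc degree} (λ i → coeff (toℕ i) * eliminated (toℕ i) r₀) λ i →
                              Signed.∣n⇒∣m*n (coeff (toℕ i)) (subst p∣_ (sym (eliminated-r₀ (toℕ i))) p∣0))
        ... | no r≢r₀  = subst p∣_ (c-eliminated r)
                           (subst (λ r → p∣ sumTo (suc degree) (λ i → coeff i * eliminated i r))
                                  (punchIn-punchOut (r≢r₀ ∘ sym)) (relation (punchOut (r≢r₀ ∘ sym))))

    dependence : ∀ n (w : ℕ → Vector n) → LinearDependence w
    dependence zero    w = dependence-degree0 w λ ()
    dependence (suc n) w with all? (λ r → + p Signed.∣? w 0 r)
    ... | yes p∣w₀ = dependence-degree0 w p∣w₀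
    ... | no ¬p∣w₀ with ¬∀⟶∃¬ (suc n) _ (λ r → + p Signed.∣? w 0 r) ¬p∣w₀
    ...   | r₀ , p∤pivot = Elimination.dependence-lift w r₀ p∤pivot (dependence n _)

    p∣-cancelˡ : ∀ {x} y → ¬ p∣ x → p∣ x * y → p∣ y
    p∣-cancelˡ {x} y p∤x p∣xy = [ (λ p∣x → contradiction p∣x p∤x) , id ]′ (p∣-euclid x y p∣xy)

    recurrence-vanishing : ∀ (c : ℕ → ℤ) d (f : ℕ → ℤ) → ¬ p∣ c d →
      (∀ t → p∣ sumTo (suc d) (λ i → c i * f (t ℕ.+ i))) →
      (∀ j → j < d → p∣ f j) → ∀ j → p∣ f j
    recurrence-vanishing c d f p∤cd recurrence initial = <-rec (p∣_ ∘ f) step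
      where
      step : ∀ j → (∀ {k} → k < j → p∣ f k) → p∣ f j
      step j earlier with j <? d
      ... | yes j<d = initial j j<d
      ... | no  j≮d = subst (p∣_ ∘ f) t+d≡j (p∣-cancelˡ (f (t ℕ.+ d)) p∤cd p∣last)
        where
        t : ℕ
        t = j ∸ d
        t+d≡j : t ℕ.+ d ≡ j
        t+d≡j = ℕ.m∸n+n≡m (ℕ.≮⇒≥ j≮d)
        h : ℕ → ℤ
        h i = c i * f (t ℕ.+ i)
        p∣init : p∣ sumTo d h
        p∣init = p∣-∑ (h ∘ toℕ) λ i → Signed.∣n⇒∣m*n (c (toℕ i))
          (earlier (subst (t ℕ.+ toℕ i <_) t+d≡j (ℕ.+-monoʳ-< t (toℕ<n i))))
        p∣last : p∣ c d * f (t ℕ.+ d)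
        p∣last = Signed.∣m+n∣m⇒∣n (subst p∣_ (sumTo-suc d h) (recurrence t)) p∣init

    module Walks {n} (A : Matrix n n) (α : Vector n) where

      rowPower : ℕ → Vector n
      rowPower zero    = α
      rowPower (suc t) = rowPower t ᵀ* A

      rowPower-powOnes : ∀ t k → rowPower t · powOnes A k ≡ α · powOnes A (t ℕ.+ k)
      rowPower-powOnes zero    k = refl
      rowPower-powOnes (suc t) k = begin
        rowPower t ᵀ* A · powOnes A k     ≡⟨ ·-ᵀ* (rowPower t) A (powOnes A k) ⟩
        rowPower t · powOnes A (suc k)    ≡⟨ rowPower-powOnes t (suc k) ⟩
        α · powOnes A (t ℕ.+ suc k)       ≡⟨ cong (λ j → α · powOnes A j) (ℕ.+-suc t k) ⟩
        α · powOnes A (suc t ℕ.+ k)       ∎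

      walks-vanish : InLeftNullSpaceMod p (walkMatrixOf A) α → ∀ j → p∣ α · powOnes A j
      walks-vanish αW≡0 = recurrence-vanishing coeff degree (λ j → α · powOnes A j) p∤leading shifted initial
        where
        open LinearDependence (dependence n (powOnes A))
        shifted : ∀ t → p∣ sumTo (suc degree) (λ i → coeff i * (α · powOnes A (t ℕ.+ i)))
        shifted t = subst p∣_
          (trans (·-∑ {k = suc degree} (rowPower t) (coeff ∘ toℕ) (powOnes A ∘ toℕ))
                 (sum-cong-≗ {suc degree} λ i → cong (coeff (toℕ i) *_) (rowPower-powOnes t (toℕ i))))
          (p∣-∑ (λ r → rowPower t r * sumTo (suc degree) (λ i → coeff i * powOnes A i r)) λ r →
             Signed.∣n⇒∣m*n (rowPower t r) (relation r))
        initial : ∀ j → j < degree → p∣ α · powOnes A j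
        initial j j<d = subst (λ k → p∣ α · powOnes A k) (toℕ-fromℕ< j<n)
          (subst p∣_ (sumFin≡sum n _) (Signed.∣ᵤ⇒∣ (αW≡0 (fromℕ< j<n))))
          where
          j<n : j < n
          j<n = ℕ.<-≤-trans j<d degree≤n

      Orthogonal : Vector n → Set
      Orthogonal y = ∀ t → p∣ rowPower t · y

      orthogonal-walkClosed : InLeftNullSpaceMod p (walkMatrixOf A) α → IsWalkClosed A Orthogonal
      orthogonal-walkClosed αW≡0 = record
        { ≗-closed = λ x≗y x⊥ t → subst p∣_ (sum-cong-≗ λ i → cong (rowPower t i *_) (x≗y i)) (x⊥ t)
        ; ∑-closed = λ g Y Y⊥ t → subst p∣_ (sym (·-∑ (rowPower t) g Y))
                                          (p∣-∑ _ λ i → Signed.∣n⇒∣m*n (g i) (Y⊥ i t))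
        ; A-closed = λ {y} y⊥ t → subst p∣_ (·-ᵀ* (rowPower t) A y) (y⊥ (suc t))
        ; ones     = λ t → subst p∣_ (sym (rowPower-powOnes t 0)) (walks-vanish αW≡0 (t ℕ.+ 0))
        }

lemma5p7 : (n m : ℕ) (G : Graph n) (H : Graph m) (v : Fin m) (p : ℕ) →
    Prime p → p ≢ 2 → (+ p) ∣ det n (walkMatrix G) →
    (α : Vector n) → InLeftNullSpaceMod p (walkMatrix G) α →
    (u : Vector m) → InLeftNullSpaceMod p (rootedProductWalkMatrix G H v) (kronVec u α)
lemma5p7 n m G H v p p-prime _ _ α αW≡0 u k = Signed.∣⇒∣ᵤ (subst p∣_ (sym blockwise) p∣blocks)
  where
  open Modulo p
  open Walks p-prime (adjMatrix G) α
  open RootedProduct G H v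
  walk : Vector (m ℕ.* n)
  walk = powOnes (rootedProductAdjMatrix G H v) (toℕ k)
  blockwise : sumFin (m ℕ.* n) (λ x → kronVec u α x * walk x) ≡ ∑[ a < m ] (u a * (α · slice walk a))
  blockwise = trans (sumFin≡sum (m ℕ.* n) _) (·-kronVec u α walk)
  p∣blocks : p∣ ∑[ a < m ] (u a * (α · slice walk a))
  p∣blocks = p∣-∑ _ λ a →
    Signed.∣n⇒∣m*n (u a) (walkSlices-closed (orthogonal-walkClosed αW≡0) (toℕ k) a 0)
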